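{- Let $A,B$ be non-empty sets, $I$ a non-empty index set, $\{V_i\}_{i\in I}\subseteq\mathcal{R}(A)$, $\{W_i\}_{i\in I}\subseteq\mathcal{R}(B)$, $Z\in\mathcal{R}(A,B)$, and let $R\in\mathcal{R}(A,B)$ be a solution to $WL^{2\text{ - }3}(A,B,I,V_i,W_i,Z)$. Then (a) $R\circ R^{ -1}$ is a solution to $WL^{1\text{ - }4}(A,I,V_i,Z\circ Z^{ -1})$; (b) $R^{ -1}\circ R$ is a solution to $WL^{1\text{ - }4}(B,I,W_i,Z^{ -1}\circ Z)$.
   Context: $\mathcal{L}=(L,\wedge,\vee,\otimes,\to,0,1)$ is a complete residuated lattice. $\mathcal{R}(X,Y)$: fuzzy relations $X\times Y\to L$ ordered pointwise, $\mathcal{R}(X)=\mathcal{R}(X,X)$; $R^{ -1}(y,x)=R(x,y)$; $(R\circ S)(x,z)=\bigvee_y R(x,y)\otimes S(y,z)$. $WL^{2\text{ - }3}(A,B,I,V_i,W_i,Z)$ (unknown $U\in\mathcal{R}(A,B)$): $U^{ -1}\circ V_i\le W_i\circ U^{ -1}$ and $U\circ W_i\le V_i\circ U$ for all $i\in I$, and $U\le Z$. For a set $X$, $\{T_i\}_{i\in I}\subseteq\mathcal{R}(X)$ and $W\in\mathcal{R}(X)$, $WL^{1\text{ - }4}(X,I,T_i,W)$ (unknown $U\in\mathcal{R}(X)$): $U\circ T_i\le T_i\circ U$, $U^{ -1}\circ T_i\le T_i\circ U^{ -1}$ for all $i\in I$, $U\le W$, $U^{ -1}\le W$. -}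

module Defs where

open import Level using (Level; suc; _⊔_)
open import Data.Product using (_×_; Σ; _,_)
open import Relation.Binary.PropositionalEquality using (_≡_)

-- Equality of lattice elements is propositional equality (≤ antisymmetric).
record CompleteResiduatedLattice (c ℓ : Level) : Set (suc (c ⊔ ℓ)) where
  infixr 7 _⊗_
  infixr 5 _⇒_
  infix 4 _≤_
  field
    Carrier : Set c
    _≤_     : Carrier → Carrier → Set c
    ≤-refl  : ∀ {x} → x ≤ x
    ≤-trans : ∀ {x y z} → x ≤ y → y ≤ z → x ≤ z
    ≤-antisym : ∀ {x y} → x ≤ y → y ≤ x → x ≡ y
    ⋁       : {J : Set ℓ} → (J → Carrier) → Carrier
    ⋁-upper : ∀ {J : Set ℓ} (f : J → Carrier) (j : J) → f j ≤ ⋁ f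
    ⋁-least : ∀ {J : Set ℓ} (f : J → Carrier) (z : Carrier) →
              (∀ j → f j ≤ z) → ⋁ f ≤ z
    _∧_ _∨_ : Carrier → Carrier → Carrier
    ∧-lb₁   : ∀ x y → (x ∧ y) ≤ x
    ∧-lb₂   : ∀ x y → (x ∧ y) ≤ y
    ∧-glb   : ∀ x y z → z ≤ x → z ≤ y → z ≤ (x ∧ y)
    ∨-ub₁   : ∀ x y → x ≤ (x ∨ y)
    ∨-ub₂   : ∀ x y → y ≤ (x ∨ y)
    ∨-lub   : ∀ x y z → x ≤ z → y ≤ z → (x ∨ y) ≤ z
    𝟘 𝟙     : Carrier
    𝟘-least : ∀ x → 𝟘 ≤ x
    𝟙-greatest : ∀ x → x ≤ 𝟙
    _⊗_     : Carrier → Carrier → Carrier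
    ⊗-assoc : ∀ x y z → (x ⊗ y) ⊗ z ≡ x ⊗ (y ⊗ z)
    ⊗-comm  : ∀ x y → x ⊗ y ≡ y ⊗ x
    ⊗-identityˡ : ∀ x → 𝟙 ⊗ x ≡ x
    _⇒_     : Carrier → Carrier → Carrier
    adj→    : ∀ {x y z} → (x ⊗ y) ≤ z → x ≤ (y ⇒ z)
    adj←    : ∀ {x y z} → x ≤ (y ⇒ z) → (x ⊗ y) ≤ z

module FuzzyRelations {c ℓ : Level} (𝓛 : CompleteResiduatedLattice c ℓ) where
  open CompleteResiduatedLattice 𝓛

  Rel : Set ℓ → Set ℓ → Set (c ⊔ ℓ)
  Rel X Y = X → Y → Carrier

  _⊑_ : {X Y : Set ℓ} → Rel X Y → Rel X Y → Set (c ⊔ ℓ)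
  R ⊑ S = ∀ x y → R x y ≤ S x y

  _⁻¹ : {X Y : Set ℓ} → Rel X Y → Rel Y X
  (R ⁻¹) y x = R x y

  _∘ᵣ_ : {X Y Z : Set ℓ} → Rel X Y → Rel Y Z → Rel X Z
  (R ∘ᵣ S) x z = ⋁ (λ y → R x y ⊗ S y z)

  infix 4 _⊑_
  infixl 6 _∘ᵣ_

  IsSolWL23 : (A B I : Set ℓ) → (I → Rel A A) → (I → Rel B B) → Rel A B →
              Rel A B → Set (c ⊔ ℓ)
  IsSolWL23 A B I V W Z U =
    (∀ i → (U ⁻¹) ∘ᵣ V i ⊑ W i ∘ᵣ (U ⁻¹)) ×
    (∀ i → U ∘ᵣ W i ⊑ V i ∘ᵣ U) ×
    U ⊑ Z

  IsSolWL14 : (X I : Set ℓ) → (I → Rel X X) → Rel X X → Rel X X → Set (c ⊔ ℓ)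
  IsSolWL14 X I T W U =
    (∀ i → U ∘ᵣ T i ⊑ T i ∘ᵣ U) ×
    (∀ i → (U ⁻¹) ∘ᵣ T i ⊑ T i ∘ᵣ (U ⁻¹)) ×
    U ⊑ W ×
    (U ⁻¹) ⊑ W

module Submission where

-- Call U ⊑-commuting with (V, W) when U ∘ W ⊑ V ∘ U.  Such
-- one-sided commutations compose: if P ∘ W ⊑ V ∘ P and Q ∘ T ⊑ W ∘ Q then
-- (P ∘ Q) ∘ T ⊑ V ∘ (P ∘ Q), by associativity and monotonicity of ∘.
-- A solution R of WL²⁻³(A,B,I,Vᵢ,Wᵢ,Z) gives exactly the two commutations
-- R ∘ Wᵢ ⊑ Vᵢ ∘ R and R⁻¹ ∘ Vᵢ ⊑ Wᵢ ∘ R⁻¹, hence R ∘ R⁻¹ commutes with Vᵢ.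
-- Since R ∘ R⁻¹ is symmetric, the commutation for its converse is the same
-- inequality, and R ⊑ Z gives R ∘ R⁻¹ ⊑ Z ∘ Z⁻¹ by monotonicity.  Part (b) is part (a) applied to R⁻¹, which solves the converse
-- system WL²⁻³(B,A,I,Wᵢ,Vᵢ,Z⁻¹).

open import Defs
open import Level using (Level; _⊔_)
open import Data.Product using (_×_; _,_)
open import Relation.Binary.Bundles using (Preorder)
open import Relation.Binary.PropositionalEquality
  using (_≡_; subst; sym; isEquivalence)
import Relation.Binary.Reasoning.Preorder as PreorderReasoning

module LatticeFacts {c ℓ : Level} (𝓛 : CompleteResiduatedLattice c ℓ) where
  open CompleteResiduatedLattice 𝓛

  ≡⇒≤ : ∀ {x y} → x ≡ y → x ≤ y
  ≡⇒≤ {x} x≡y = subst (x ≤_) x≡y ≤-refl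

  ≤-preorder : Preorder c c c
  ≤-preorder = record
    { Carrier = Carrier ; _≈_ = _≡_ ; _≲_ = _≤_
    ; isPreorder = record
      { isEquivalence = isEquivalence ; reflexive = ≡⇒≤ ; trans = ≤-trans } }

  open PreorderReasoning ≤-preorder

  ⊗-monoˡ : ∀ {x x′ y} → x ≤ x′ → x ⊗ y ≤ x′ ⊗ y
  ⊗-monoˡ x≤x′ = adj← (≤-trans x≤x′ (adj→ ≤-refl))

  ⊗-monoʳ : ∀ {x y y′} → y ≤ y′ → x ⊗ y ≤ x ⊗ y′
  ⊗-monoʳ {x} {y} {y′} y≤y′ = begin
    x ⊗ y   ≡⟨ ⊗-comm x y ⟩
    y ⊗ x   ≲⟨ ⊗-monoˡ y≤y′ ⟩
    y′ ⊗ x  ≡⟨ ⊗-comm y′ x ⟩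
    x ⊗ y′  ∎

  -- ⊗ distributes over arbitrary joins: - ⊗ t is a left adjoint, so it
  -- preserves suprema.
  ⊗-distribʳ-⋁ : ∀ {J : Set ℓ} (f : J → Carrier) t →
                 (⋁ f) ⊗ t ≤ ⋁ (λ j → f j ⊗ t)
  ⊗-distribʳ-⋁ f t =
    adj← (⋁-least f _ (λ j → adj→ (⋁-upper (λ j → f j ⊗ t) j)))

  ⊗-distribˡ-⋁ : ∀ {J : Set ℓ} (f : J → Carrier) t →
                 t ⊗ (⋁ f) ≤ ⋁ (λ j → t ⊗ f j)
  ⊗-distribˡ-⋁ f t = begin
    t ⊗ ⋁ f                ≡⟨ ⊗-comm t (⋁ f) ⟩
    ⋁ f ⊗ t                ≲⟨ ⊗-distribʳ-⋁ f t ⟩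
    ⋁ (λ j → f j ⊗ t)      ≲⟨ ⋁-least _ _ (λ j → ≤-trans (≡⇒≤ (⊗-comm (f j) t))
                                                  (⋁-upper (λ j → t ⊗ f j) j)) ⟩
    ⋁ (λ j → t ⊗ f j)      ∎

module RelationAlgebra {c ℓ : Level} (𝓛 : CompleteResiduatedLattice c ℓ) where
  open CompleteResiduatedLattice 𝓛
  open FuzzyRelations 𝓛
  open LatticeFacts 𝓛

  ⊑-refl : ∀ {X Y : Set ℓ} {R : Rel X Y} → R ⊑ R
  ⊑-refl x y = ≤-refl

  ⊑-preorder : (X Y : Set ℓ) → Preorder (c ⊔ ℓ) (c ⊔ ℓ) (c ⊔ ℓ)
  ⊑-preorder X Y = record
    { Carrier = Rel X Y ; _≈_ = _≡_ ; _≲_ = _⊑_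
    ; isPreorder = record
      { isEquivalence = isEquivalence
      ; reflexive = λ { {R} R≡S → subst (R ⊑_) R≡S ⊑-refl }
      ; trans = λ R⊑S S⊑T x y → ≤-trans (R⊑S x y) (S⊑T x y) } }

  ⁻¹-mono : ∀ {X Y : Set ℓ} {R S : Rel X Y} → R ⊑ S → R ⁻¹ ⊑ S ⁻¹
  ⁻¹-mono R⊑S y x = R⊑S x y

  ∘-mono : ∀ {X Y Z : Set ℓ} {R R′ : Rel X Y} {S S′ : Rel Y Z} →
           R ⊑ R′ → S ⊑ S′ → R ∘ᵣ S ⊑ R′ ∘ᵣ S′
  ∘-mono {R′ = R′} {S′ = S′} R⊑R′ S⊑S′ x z = ⋁-least _ _ λ y →
    ≤-trans (⊗-monoˡ (R⊑R′ x y))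
      (≤-trans (⊗-monoʳ (S⊑S′ y z)) (⋁-upper (λ y → R′ x y ⊗ S′ y z) y))

  ∘-assocʳ : ∀ {X Y Z W : Set ℓ} (R : Rel X Y) (S : Rel Y Z) (T : Rel Z W) →
             (R ∘ᵣ S) ∘ᵣ T ⊑ R ∘ᵣ (S ∘ᵣ T)
  ∘-assocʳ R S T x w = ⋁-least _ _ λ z → begin
    (R ∘ᵣ S) x z ⊗ T z w               ≲⟨ ⊗-distribʳ-⋁ _ (T z w) ⟩
    ⋁ (λ y → (R x y ⊗ S y z) ⊗ T z w)  ≲⟨ ⋁-least _ _ (λ y → begin
        (R x y ⊗ S y z) ⊗ T z w         ≡⟨ ⊗-assoc (R x y) (S y z) (T z w) ⟩
        R x y ⊗ (S y z ⊗ T z w)         ≲⟨ ⊗-monoʳ (⋁-upper (λ z → S y z ⊗ T z w) z) ⟩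
        R x y ⊗ (S ∘ᵣ T) y w            ≲⟨ ⋁-upper (λ y → R x y ⊗ (S ∘ᵣ T) y w) y ⟩
        (R ∘ᵣ (S ∘ᵣ T)) x w             ∎) ⟩
    (R ∘ᵣ (S ∘ᵣ T)) x w                ∎
    where open PreorderReasoning ≤-preorder

  ∘-assocˡ : ∀ {X Y Z W : Set ℓ} (R : Rel X Y) (S : Rel Y Z) (T : Rel Z W) →
             R ∘ᵣ (S ∘ᵣ T) ⊑ (R ∘ᵣ S) ∘ᵣ T
  ∘-assocˡ R S T x w = ⋁-least _ _ λ y → begin
    R x y ⊗ (S ∘ᵣ T) y w               ≲⟨ ⊗-distribˡ-⋁ _ (R x y) ⟩
    ⋁ (λ z → R x y ⊗ (S y z ⊗ T z w))  ≲⟨ ⋁-least _ _ (λ z → begin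
        R x y ⊗ (S y z ⊗ T z w)         ≡⟨ sym (⊗-assoc (R x y) (S y z) (T z w)) ⟩
        (R x y ⊗ S y z) ⊗ T z w         ≲⟨ ⊗-monoˡ (⋁-upper (λ y → R x y ⊗ S y z) y) ⟩
        (R ∘ᵣ S) x z ⊗ T z w            ≲⟨ ⋁-upper (λ z → (R ∘ᵣ S) x z ⊗ T z w) z ⟩
        ((R ∘ᵣ S) ∘ᵣ T) x w             ∎) ⟩
    ((R ∘ᵣ S) ∘ᵣ T) x w                ∎
    where open PreorderReasoning ≤-preorder

  -- A relation is symmetric when its converse is contained in it
  -- (the reverse inclusion then follows by taking converses).
  Symmetric : {X : Set ℓ} → Rel X X → Set (c ⊔ ℓ)
  Symmetric U = U ⁻¹ ⊑ U

  -- R ∘ R⁻¹ is symmetric, by commutativity of ⊗.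
  ∘-converse-symmetric : ∀ {X Y : Set ℓ} (R : Rel X Y) → Symmetric (R ∘ᵣ R ⁻¹)
  ∘-converse-symmetric R x y = ⋁-least _ _ λ b →
    ≤-trans (≡⇒≤ (⊗-comm (R y b) (R x b))) (⋁-upper (λ b → R x b ⊗ R y b) b)

module Commutation {c ℓ : Level} (𝓛 : CompleteResiduatedLattice c ℓ) where
  open FuzzyRelations 𝓛
  open RelationAlgebra 𝓛

  Commutes : {X Y : Set ℓ} → Rel X Y → Rel X X → Rel Y Y → Set (c ⊔ ℓ)
  Commutes U V W = U ∘ᵣ W ⊑ V ∘ᵣ U

  commutes-∘ : ∀ {X Y Z : Set ℓ} {P : Rel X Y} {Q : Rel Y Z}
                 {V : Rel X X} {W : Rel Y Y} {T : Rel Z Z} →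
               Commutes P V W → Commutes Q W T → Commutes (P ∘ᵣ Q) V T
  commutes-∘ {P = P} {Q} {V} {W} {T} PVW QWT = begin
    (P ∘ᵣ Q) ∘ᵣ T   ≲⟨ ∘-assocʳ P Q T ⟩
    P ∘ᵣ (Q ∘ᵣ T)   ≲⟨ ∘-mono ⊑-refl QWT ⟩
    P ∘ᵣ (W ∘ᵣ Q)   ≲⟨ ∘-assocˡ P W Q ⟩
    (P ∘ᵣ W) ∘ᵣ Q   ≲⟨ ∘-mono PVW ⊑-refl ⟩
    (V ∘ᵣ P) ∘ᵣ Q   ≲⟨ ∘-assocʳ V P Q ⟩
    V ∘ᵣ (P ∘ᵣ Q)   ∎
    where open PreorderReasoning (⊑-preorder _ _)

  commutes-converse : ∀ {X : Set ℓ} {U T : Rel X X} → Symmetric U →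
                      Commutes U T T → Commutes (U ⁻¹) T T
  commutes-converse {U = U} {T} U-sym UTT = begin
    U ⁻¹ ∘ᵣ T   ≲⟨ ∘-mono U-sym ⊑-refl ⟩
    U ∘ᵣ T      ≲⟨ UTT ⟩
    T ∘ᵣ U      ≲⟨ ∘-mono ⊑-refl (⁻¹-mono U-sym) ⟩
    T ∘ᵣ U ⁻¹   ∎
    where open PreorderReasoning (⊑-preorder _ _)

  symmetric-solWL14 : ∀ {X I : Set ℓ} {T : I → Rel X X} {W U : Rel X X} →
                      Symmetric U → (∀ i → Commutes U (T i) (T i)) → U ⊑ W →
                      IsSolWL14 X I T W U
  symmetric-solWL14 U-sym UT U⊑W =
    UT , (λ i → commutes-converse U-sym (UT i)) , U⊑W ,
    λ x y → ≤-trans (U-sym x y) (U⊑W x y)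
    where open CompleteResiduatedLattice 𝓛

  converse-solWL23 : ∀ {A B I : Set ℓ} {V : I → Rel A A} {W : I → Rel B B}
                       {Z R : Rel A B} →
                     IsSolWL23 A B I V W Z R → IsSolWL23 B A I W V (Z ⁻¹) (R ⁻¹)
  converse-solWL23 (R⁻¹VW , RWV , R⊑Z) = RWV , R⁻¹VW , ⁻¹-mono R⊑Z

  kernel-solWL14 : ∀ {A B I : Set ℓ} {V : I → Rel A A} {W : I → Rel B B}
                     {Z R : Rel A B} →
                   IsSolWL23 A B I V W Z R →
                   IsSolWL14 A I V (Z ∘ᵣ Z ⁻¹) (R ∘ᵣ R ⁻¹)
  kernel-solWL14 {R = R} (R⁻¹VW , RWV , R⊑Z) =
    symmetric-solWL14 (∘-converse-symmetric R)
      (λ i → commutes-∘ (RWV i) (R⁻¹VW i))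
      (∘-mono R⊑Z (⁻¹-mono R⊑Z))

proposition7p1 : {c ℓ : Level} (𝓛 : CompleteResiduatedLattice c ℓ) →
    let open FuzzyRelations 𝓛 in
    (A B I : Set ℓ) → A → B → I →
    (V : I → Rel A A) (W : I → Rel B B) (Z : Rel A B) (R : Rel A B) →
    IsSolWL23 A B I V W Z R →
    IsSolWL14 A I V (Z ∘ᵣ (Z ⁻¹)) (R ∘ᵣ (R ⁻¹)) ×
    IsSolWL14 B I W ((Z ⁻¹) ∘ᵣ Z) ((R ⁻¹) ∘ᵣ R)
proposition7p1 𝓛 A B I _ _ _ V W Z R sol =
  kernel-solWL14 sol , kernel-solWL14 (converse-solWL23 sol)
  where open Commutation 𝓛
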